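{- For every $\epsilon>0$ there exist a connected graph $G$ and an edge-weight function $\omega: E(G)\to\mathbb{R}_{\geq 0}$ with $\omega(G)>0$ such that $$\frac{t_\omega(G)}{u(G)}<\epsilon .$$
   Context: Graphs are finite, simple and undirected. For a connected graph $G$ and a function $\omega:E(G)\to\mathbb{R}_{\ge 0}$, write $\omega(H)=\sum_{e\in E(H)}\omega(e)$ for a subgraph $H$ and $\omega(G)=\sum_{e\in E(G)}\omega(e)$. Let $T_\omega$ be a maximum spanning tree of $G$ with respect to $\omega$, i.e. a spanning tree maximizing $\omega(T)$. When $\omega(G)>0$, the weighting ratio is $t_\omega(G)=\omega(T_\omega)/\omega(G)$; it does not depend on the choice of $T_\omega$. The uniform ratio is $u(G)=\frac{|V(G)|-1}{|E(G)|}$, i.e. the weighting ratio when all edges have weight $1$.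
   Formalization: The threshold ε ranges only over positive rationals, and the edge weights ω are taken in the nonnegative rationals instead of $\mathbb{R}_{\geq 0}$. -}

module Defs where

open import Data.Nat as ℕ using (ℕ; zero; suc)
open import Data.Fin using (Fin)
import Data.Nat.ListAction
open import Data.Fin.Properties using (_<?_)
open import Data.Bool using (Bool; true; false; _∧_; if_then_else_)
open import Data.Unit using (⊤)
open import Data.List using (List; []; _∷_; allFin)
open import Data.List.Relation.Unary.AllPairs using (AllPairs)
open import Data.Product using (_×_; _,_; Σ)
open import Relation.Binary.PropositionalEquality using (_≡_; _≢_)
open import Relation.Nullary using (¬_; does)
open import Data.Integer using (+_)
open import Data.Rational as ℚ using (ℚ; 0ℚ; _/_)

record Graph : Set where
  field
    n      : ℕ
    adj    : Fin n → Fin n → Bool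
    sym    : ∀ i j → adj i j ≡ adj j i
    irrefl : ∀ i → adj i i ≡ false
open Graph public

record SpanningSubgraph (G : Graph) : Set where
  field
    sub     : Fin (n G) → Fin (n G) → Bool
    sub-sym : ∀ i j → sub i j ≡ sub j i
    sub⊆    : ∀ i j → sub i j ≡ true → adj G i j ≡ true
open SpanningSubgraph public

last′ : ∀ {m} → Fin m → List (Fin m) → Fin m
last′ x []       = x
last′ x (y ∷ ys) = last′ y ys

module _ {m : ℕ} (R : Fin m → Fin m → Bool) where

  data Walk : Fin m → Fin m → Set where
    here : ∀ {u} → Walk u u
    step : ∀ {u w v} → R u w ≡ true → Walk w v → Walk u v

  Connected : Set
  Connected = ∀ u v → Walk u v

  Consec : List (Fin m) → Set
  Consec []           = ⊤
  Consec (x ∷ [])     = ⊤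
  Consec (x ∷ y ∷ xs) = (R x y ≡ true) × Consec (y ∷ xs)

  record Cycle : Set where
    field
      v₀ v₁ v₂ : Fin m
      rest     : List (Fin m)
      distinct : AllPairs _≢_ (v₀ ∷ v₁ ∷ v₂ ∷ rest)
      consec   : Consec (v₀ ∷ v₁ ∷ v₂ ∷ rest)
      closing  : R (last′ v₂ rest) v₀ ≡ true

  Acyclic : Set
  Acyclic = ¬ Cycle

-- Sums over the edge set.  An (undirected) edge {i,j} is counted once,
-- via its representative with i < j.

sumℚ : List ℚ → ℚ
sumℚ []       = 0ℚ
sumℚ (x ∷ xs) = x ℚ.+ sumℚ xs

weightOf : ∀ {m} → (Fin m → Fin m → Bool) → (Fin m → Fin m → ℚ) → ℚ
weightOf {m} R ω =
  sumℚ (Data.List.concatMap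
          (λ i → Data.List.map
                   (λ j → if does (i <? j) ∧ R i j then ω i j else 0ℚ)
                   (allFin m))
          (allFin m))

edgeCount : ∀ {m} → (Fin m → Fin m → Bool) → ℕ
edgeCount {m} R =
  Data.Nat.ListAction.sum (Data.List.concatMap
          (λ i → Data.List.map
                   (λ j → if does (i <? j) ∧ R i j then 1 else 0)
                   (allFin m))
          (allFin m))

ℕtoℚ : ℕ → ℚ
ℕtoℚ k = + k / 1

Weighting : Graph → Set
Weighting G = Fin (n G) → Fin (n G) → ℚ

-- ω : E(G) → ℚ≥0  (only the values ω i j with i < j and i ~ j are used)
NonNegWeighting : (G : Graph) → Weighting G → Set
NonNegWeighting G ω = ∀ i j → adj G i j ≡ true → 0ℚ ℚ.≤ ω i j

ωG : (G : Graph) → Weighting G → ℚ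
ωG G ω = weightOf (adj G) ω

ωH : (G : Graph) → Weighting G → SpanningSubgraph G → ℚ
ωH G ω H = weightOf (sub H) ω

IsSpanningTree : (G : Graph) → SpanningSubgraph G → Set
IsSpanningTree G T = Connected (sub T) × Acyclic (sub T)

IsMaxSpanningTree : (G : Graph) → Weighting G → SpanningSubgraph G → Set
IsMaxSpanningTree G ω T =
  IsSpanningTree G T ×
  (∀ (T′ : SpanningSubgraph G) → IsSpanningTree G T′ → ωH G ω T′ ℚ.≤ ωH G ω T)

-- t_ω(G) / u(G) < ε, where t_ω(G) = ω(T)/ω(G) and u(G) = (|V|-1)/|E|.
-- Since ω(G) > 0, |E| > 0 and |V| - 1 > 0 in the situation of the
-- theorem, this is written with the denominators cleared:
--   ω(T) · |E|  <  ε · (ω(G) · (|V| - 1)).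
RatioBelow : (G : Graph) → Weighting G → SpanningSubgraph G → ℚ → Set
RatioBelow G ω T ε =
  ωH G ω T ℚ.* ℕtoℚ (edgeCount (adj G))
    ℚ.< ε ℚ.* (ωG G ω ℚ.* ℕtoℚ (n G ℕ.∸ 1))

-- Let N = m² and let G be the complete graph on the vertices 0,…,m−1 together with a
-- star joining vertex 0 to every vertex; give the clique edges weight 1 and all other
-- edges weight 0.  A forest has at most m − 1 edges among m vertices, so the star, which
-- has exactly m − 1 clique edges, is a maximum spanning tree.  Since ω(G) = m(m−1)/2 and
-- |E(G)| ≤ m(m−1)/2 + N − 1,
--   t_ω(G) / u(G) = ω(T)·|E(G)| / (ω(G)·(N − 1)) ≤ 2 (m(m−1)/2 + N − 1) / (m (N − 1)) ≈ 3/m,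
-- which is below every ε ≥ 1/(d+1) once m = 4(d+1).

module Submission where

open import Defs hiding (sym)
open import Data.Bool using (Bool; true; false; _∧_; _∨_; if_then_else_; T)
open import Data.Bool.Properties
  using (∧-conicalˡ; ∧-conicalʳ; ∧-identityʳ; ∧-zeroʳ; ∨-zeroʳ; ∧-comm; ∧-abs-∨)
open import Data.Empty using (⊥; ⊥-elim)
open import Data.Fin as Fin using (Fin; zero; suc; toℕ)
open import Data.Fin.Properties using (_<?_; _≟_; punchInᵢ≢i; toℕ<n)
import Data.Fin.Properties as Fin
open import Data.Integer as ℤ using (+_; -[1+_]; +≤+; +<+)
import Data.Integer.Properties as ℤ
open import Data.List using (List; []; _∷_; _++_; map; concatMap; allFin; tabulate; cartesianProduct)
import Data.List.Properties as List
open import Data.List.Relation.Unary.All as All using (All; []; _∷_)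
import Data.List.Relation.Unary.All.Properties as All
open import Data.List.Relation.Unary.AllPairs as AllPairs using (AllPairs; []; _∷_)
import Data.List.Relation.Unary.AllPairs.Properties as AllPairs
open import Data.List.Relation.Unary.Any using (Any; here; there)
open import Data.List.Relation.Unary.Linked as Linked using (Linked; []; [-]; _∷_)
open import Data.List.Relation.Unary.Unique.Propositional using (Unique)
open import Data.List.Relation.Unary.Unique.Propositional.Properties using (cartesianProduct⁺; allFin⁺)
open import Data.Nat as ℕ using (ℕ; zero; suc; _+_; _*_; _∸_; _≤_; z≤n; s≤s; _<ᵇ_; _≡ᵇ_)
import Data.Nat.ListAction as List
open import Data.Nat.ListAction.Properties using (sum-++)
open import Data.Nat.Coprimality using (Coprime; 1-coprimeTo)
import Data.Nat.Coprimality as Coprimality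
import Data.Nat.Properties as ℕ
open import Algebra.Properties.Semiring.Sum ℕ.+-*-semiring
  using (sum; sum-syntax; sum-cong-≗; ∑-distrib-+; sum-remove; sum-replicate-zero)
open import Data.Nat.Tactic.RingSolver using (solve-∀)
open import Data.Product using (Σ; _×_; _,_; uncurry; ∃-syntax)
open import Data.Rational as ℚ using (ℚ; 0ℚ; 1ℚ; _<_; mkℚ; *≤*; *<*)
import Data.Rational.Properties as ℚ
open import Data.Rational.Unnormalised as ℚᵘ using (mkℚᵘ)
import Data.Rational.Unnormalised.Properties as ℚᵘ
open import Data.Sum using (_⊎_; inj₁; inj₂)
open import Data.Unit using (tt)
open import Data.Vec.Functional using (removeAt)
open import Function using (_∘_; id)
open import Relation.Nullary using (does)
open import Relation.Nullary.Decidable using (dec-true; dec-false; proof; toSum)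
open import Relation.Nullary.Reflects using (Reflects; invert)
open import Relation.Binary.PropositionalEquality

-- ℕtoℚ k normalises + k / 1, so it reduces to this normal form only for closed k.
ℕtoℚ′ : ℕ → ℚ
ℕtoℚ′ k = mkℚ (+ k) 0 (Coprimality.sym (1-coprimeTo k))

ℕtoℚ≡ℕtoℚ′ : ∀ k → ℕtoℚ k ≡ ℕtoℚ′ k
ℕtoℚ≡ℕtoℚ′ k = ℚ.normalize-coprime _

ℕtoℚ-homo-+ : ∀ a b → ℕtoℚ (a ℕ.+ b) ≡ ℕtoℚ a ℚ.+ ℕtoℚ b
ℕtoℚ-homo-+ a b = begin
  ℕtoℚ (a ℕ.+ b)        ≡⟨ cong (ℚ._/ 1) numerator ⟩
  ℕtoℚ′ a ℚ.+ ℕtoℚ′ b   ≡⟨ cong₂ ℚ._+_ (ℕtoℚ≡ℕtoℚ′ a) (ℕtoℚ≡ℕtoℚ′ b) ⟨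
  ℕtoℚ a ℚ.+ ℕtoℚ b     ∎
  where
  open ≡-Reasoning
  numerator : + (a ℕ.+ b) ≡ + a ℤ.* + 1 ℤ.+ + b ℤ.* + 1
  numerator = trans (ℤ.pos-+ a b) (sym (cong₂ ℤ._+_ (ℤ.*-identityʳ (+ a)) (ℤ.*-identityʳ (+ b))))

ℕtoℚ-homo-* : ∀ a b → ℕtoℚ (a ℕ.* b) ≡ ℕtoℚ a ℚ.* ℕtoℚ b
ℕtoℚ-homo-* a b = begin
  ℕtoℚ (a ℕ.* b)        ≡⟨ cong (ℚ._/ 1) (ℤ.pos-* a b) ⟩
  ℕtoℚ′ a ℚ.* ℕtoℚ′ b   ≡⟨ cong₂ ℚ._*_ (ℕtoℚ≡ℕtoℚ′ a) (ℕtoℚ≡ℕtoℚ′ b) ⟨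
  ℕtoℚ a ℚ.* ℕtoℚ b     ∎
  where open ≡-Reasoning

ℕtoℚ-mono-≤ : ∀ {a b} → a ℕ.≤ b → ℕtoℚ a ℚ.≤ ℕtoℚ b
ℕtoℚ-mono-≤ {a} {b} a≤b = subst₂ ℚ._≤_ (sym (ℕtoℚ≡ℕtoℚ′ a)) (sym (ℕtoℚ≡ℕtoℚ′ b))
  (*≤* (subst₂ ℤ._≤_ (sym (ℤ.*-identityʳ (+ a))) (sym (ℤ.*-identityʳ (+ b))) (+≤+ a≤b)))

ℕtoℚ-mono-< : ∀ {a b} → a ℕ.< b → ℕtoℚ a ℚ.< ℕtoℚ b
ℕtoℚ-mono-< {a} {b} a<b = subst₂ ℚ._<_ (sym (ℕtoℚ≡ℕtoℚ′ a)) (sym (ℕtoℚ≡ℕtoℚ′ b))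
  (*<* (subst₂ ℤ._<_ (sym (ℤ.*-identityʳ (+ a))) (sym (ℤ.*-identityʳ (+ b))) (+<+ a<b)))

ℕtoℚ-<-* : ∀ a b n d .(c : Coprime n (suc d)) →
           a ℕ.* suc d ℕ.< n ℕ.* b → ℕtoℚ a ℚ.< mkℚ (+ n) d c ℚ.* ℕtoℚ b
ℕtoℚ-<-* a b n d c lt rewrite ℕtoℚ≡ℕtoℚ′ a | ℕtoℚ≡ℕtoℚ′ b =
  ℚ.toℚᵘ-cancel-< (ℚᵘ.<-respʳ-≃ (ℚᵘ.≃-sym (ℚ.toℚᵘ-fromℚᵘ (mkℚᵘ (+ n ℤ.* + b) (d ℕ.* 1))))
    (ℚᵘ.*<* (subst₂ ℤ._<_ lhs rhs (+<+ lt))))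
  where
  lhs : + (a ℕ.* suc d) ≡ + a ℤ.* + suc (d ℕ.* 1)
  lhs = trans (ℤ.pos-* a (suc d)) (cong (λ k → + a ℤ.* + suc k) (sym (ℕ.*-identityʳ d)))
  rhs : + (n ℕ.* b) ≡ (+ n ℤ.* + b) ℤ.* + 1
  rhs = trans (ℤ.pos-* n b) (sym (ℤ.*-identityʳ _))

𝟙 : Bool → ℕ
𝟙 b = if b then 1 else 0

sum-tabulate : ∀ {n} (f : Fin n → ℕ) → List.sum (tabulate f) ≡ sum f
sum-tabulate {zero}  f = refl
sum-tabulate {suc n} f = cong (_+_ (f zero)) (sum-tabulate (f ∘ suc))

sum-map-allFin : ∀ {n} (f : Fin n → ℕ) → List.sum (map f (allFin n)) ≡ sum f
sum-map-allFin f = trans (cong List.sum (List.map-tabulate (λ i → i) f)) (sum-tabulate f)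

sum-concatMap : ∀ {A : Set} (F : A → List ℕ) xs →
                List.sum (concatMap F xs) ≡ List.sum (map (List.sum ∘ F) xs)
sum-concatMap F []       = refl
sum-concatMap F (x ∷ xs) = trans (sum-++ (F x) _) (cong (_+_ (List.sum (F x))) (sum-concatMap F xs))

∑-zero : ∀ {n} {f : Fin n → ℕ} → (∀ i → f i ≡ 0) → sum f ≡ 0
∑-zero {n} f≡0 = trans (sum-cong-≗ {n} f≡0) (sum-replicate-zero n)

∑-mono-≤ : ∀ {n} {f g : Fin n → ℕ} → (∀ i → f i ≤ g i) → sum f ≤ sum g
∑-mono-≤ {zero}  f≤g = z≤n
∑-mono-≤ {suc n} f≤g = ℕ.+-mono-≤ (f≤g zero) (∑-mono-≤ (f≤g ∘ suc))

term≤∑ : ∀ {n} (f : Fin n → ℕ) i → f i ≤ sum f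
term≤∑ {suc n} f i = ℕ.≤-trans (ℕ.m≤m+n (f i) _) (ℕ.≤-reflexive (sym (sum-remove f)))

∑-suc-at : ∀ {n} (f g : Fin n → ℕ) r → f r ≡ suc (g r) → (∀ x → x ≢ r → f x ≡ g x) →
           sum f ≡ suc (sum g)
∑-suc-at {suc n} f g r fr≡1+gr f≡g = begin
  sum f                             ≡⟨ sum-remove f ⟩
  f r + sum (removeAt f r)          ≡⟨ cong₂ _+_ fr≡1+gr (sum-cong-≗ {n} (λ x → f≡g _ (punchInᵢ≢i r x))) ⟩
  suc (g r + sum (removeAt g r))    ≡⟨ cong suc (sum-remove g) ⟨
  suc (sum g)                       ∎
  where open ≡-Reasoning

𝟙-∨ : ∀ x y → 𝟙 (x ∨ y) ≤ 𝟙 x + 𝟙 y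
𝟙-∨ true  y = s≤s z≤n
𝟙-∨ false y = ℕ.≤-refl

edgeCount≡∑∑ : ∀ {N} (R : Fin N → Fin N → Bool) →
               edgeCount R ≡ ∑[ i < N ] ∑[ j < N ] 𝟙 (does (i <? j) ∧ R i j)
edgeCount≡∑∑ {N} R = trans (sum-concatMap _ (allFin N))
  (trans (sum-map-allFin {N} _) (sum-cong-≗ {N} (λ i → sum-map-allFin {N} _)))

sumℚ-map-ℕtoℚ : ∀ ns → sumℚ (map ℕtoℚ ns) ≡ ℕtoℚ (List.sum ns)
sumℚ-map-ℕtoℚ []       = refl
sumℚ-map-ℕtoℚ (n ∷ ns) = trans (cong (ℕtoℚ n ℚ.+_) (sumℚ-map-ℕtoℚ ns)) (sym (ℕtoℚ-homo-+ n _))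

ℕtoℚ-𝟙-∧ : ∀ b r s → ℕtoℚ (𝟙 (b ∧ (r ∧ s))) ≡ (if b ∧ r then (if s then 1ℚ else 0ℚ) else 0ℚ)
ℕtoℚ-𝟙-∧ false r     s     = refl
ℕtoℚ-𝟙-∧ true  false s     = refl
ℕtoℚ-𝟙-∧ true  true  false = refl
ℕtoℚ-𝟙-∧ true  true  true  = refl

weightOf-indicator : ∀ {N} (R S : Fin N → Fin N → Bool) →
  weightOf R (λ i j → if S i j then 1ℚ else 0ℚ) ≡ ℕtoℚ (edgeCount (λ i j → R i j ∧ S i j))
weightOf-indicator {N} R S = begin
  weightOf R (λ i j → if S i j then 1ℚ else 0ℚ)
    ≡⟨ cong sumℚ (List.concatMap-cong row (allFin N)) ⟩
  sumℚ (concatMap (λ i → map ℕtoℚ (map (count i) (allFin N))) (allFin N))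
    ≡⟨ cong sumℚ (List.map-concatMap ℕtoℚ (λ i → map (count i) (allFin N)) (allFin N)) ⟨
  sumℚ (map ℕtoℚ (concatMap (λ i → map (count i) (allFin N)) (allFin N)))
    ≡⟨ sumℚ-map-ℕtoℚ (concatMap (λ i → map (count i) (allFin N)) (allFin N)) ⟩
  ℕtoℚ (edgeCount (λ i j → R i j ∧ S i j)) ∎
  where
  open ≡-Reasoning
  weight : Fin N → Fin N → ℚ
  weight i j = if does (i <? j) ∧ R i j then (if S i j then 1ℚ else 0ℚ) else 0ℚ
  count : Fin N → Fin N → ℕ
  count i j = 𝟙 (does (i <? j) ∧ (R i j ∧ S i j))
  row : ∀ i → map (weight i) (allFin N) ≡ map ℕtoℚ (map (count i) (allFin N))
  row i = trans (List.map-cong (λ j → sym (ℕtoℚ-𝟙-∧ (does (i <? j)) (R i j) (S i j))) (allFin N))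
                (List.map-∘ (allFin N))

count-below : ∀ {N} m → m ≤ N → ∑[ j < N ] 𝟙 (toℕ j <ᵇ m) ≡ m
count-below {zero}  zero    z≤n      = refl
count-below {suc N} zero    _        = ∑-zero {suc N} (λ _ → refl)
count-below {suc N} (suc m) (s≤s m≤N) = cong suc (count-below m m≤N)

count-between : ∀ {N} a m → m ≤ N → ∑[ j < N ] 𝟙 ((a <ᵇ toℕ j) ∧ (toℕ j <ᵇ m)) ≡ m ∸ suc a
count-between {zero}  a       zero    z≤n       = refl
count-between {suc N} a       zero    _         = ∑-zero {suc N} (λ j → cong 𝟙 (∧-zeroʳ (a <ᵇ toℕ j)))
count-between {suc N} zero    (suc m) (s≤s m≤N) = count-below m m≤N
count-between {suc N} (suc a) (suc m) (s≤s m≤N) = count-between a m m≤N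

count-pairs-below : ∀ {N} m → m ≤ N →
  2 * ∑[ i < N ] ∑[ j < N ] 𝟙 ((toℕ i <ᵇ toℕ j) ∧ (toℕ j <ᵇ m)) ≡ m * (m ∸ 1)
count-pairs-below {N} m m≤N =
  trans (cong (2 *_) (sum-cong-≗ {N} (λ i → count-between (toℕ i) m m≤N))) (triangle m m≤N)
  where
  triangle : ∀ {N} m → m ≤ N → 2 * ∑[ i < N ] (m ∸ suc (toℕ i)) ≡ m * (m ∸ 1)
  triangle {zero}  zero    z≤n       = refl
  triangle {suc N} zero    _         = cong (2 *_) (∑-zero {suc N} (λ _ → refl))
  triangle {suc N} (suc m) (s≤s m≤N) = begin
    2 * (m + ∑[ i < N ] (m ∸ suc (toℕ i))) ≡⟨ ℕ.*-distribˡ-+ 2 m _ ⟩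
    2 * m + 2 * ∑[ i < N ] (m ∸ suc (toℕ i)) ≡⟨ cong (_+_ (2 * m)) (triangle m m≤N) ⟩
    2 * m + m * (m ∸ 1)                   ≡⟨ gauss m ⟩
    suc m * m                             ∎
    where
    open ≡-Reasoning
    gauss : ∀ m → 2 * m + m * (m ∸ 1) ≡ suc m * m
    gauss zero    = refl
    gauss (suc k) = identity k
      where
      identity : ∀ k → 2 * suc k + suc k * k ≡ suc (suc k) * suc k
      identity = solve-∀

count-star : ∀ {N} m → m ≤ N →
  ∑[ i < N ] ∑[ j < N ] 𝟙 ((toℕ i <ᵇ toℕ j) ∧ ((toℕ i ≡ᵇ 0) ∧ (toℕ j <ᵇ m))) ≡ m ∸ 1
count-star {zero}  zero z≤n = refl
count-star {suc N} m    m≤N = begin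
  row₀ + ∑[ i < N ] ∑[ j < suc N ] 𝟙 ((suc (toℕ i) <ᵇ toℕ j) ∧ false)
    ≡⟨ cong (_+_ row₀) (∑-zero {N} (λ i → ∑-zero {suc N} (λ j →
         cong 𝟙 (∧-zeroʳ (suc (toℕ i) <ᵇ toℕ j))))) ⟩
  row₀ + 0 ≡⟨ ℕ.+-identityʳ row₀ ⟩
  row₀     ≡⟨ count-between 0 m m≤N ⟩
  m ∸ 1    ∎
  where
  open ≡-Reasoning
  row₀ : ℕ
  row₀ = ∑[ j < suc N ] 𝟙 ((0 <ᵇ toℕ j) ∧ (toℕ j <ᵇ m))

module _ {m : ℕ} where

  walk-++ : ∀ {R : Fin m → Fin m → Bool} {u w v} → Walk R u w → Walk R w v → Walk R u v
  walk-++ here       q = q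
  walk-++ (step e p) q = step e (walk-++ p q)

  walk-map : ∀ {R S : Fin m → Fin m → Bool} → (∀ u v → R u v ≡ true → S u v ≡ true) →
             ∀ {u v} → Walk R u v → Walk S u v
  walk-map R⊆S here               = here
  walk-map R⊆S (step {u} {w} e p) = step (R⊆S u w e) (walk-map R⊆S p)

  cycle-v₂-neighbour : ∀ {R : Fin m → Fin m → Bool} (C : Cycle R) →
    ∃[ w ] R (Cycle.v₂ C) w ≡ true × w ≢ Cycle.v₁ C
  cycle-v₂-neighbour record { rest = [] ; distinct = (v₀≢v₁ ∷ _) ∷ _ ; closing = e } =
    _ , e , v₀≢v₁
  cycle-v₂-neighbour record { rest = x ∷ _ ; distinct = _ ∷ (_ ∷ v₁≢x ∷ _) ∷ _ ; consec = _ , _ , e , _ } =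
    x , e , λ x≡v₁ → v₁≢x (sym x≡v₁)

  -- The two edges at v₁ both touch c, forcing v₁ = c; then the edge from v₂ to its other
  -- neighbour cannot touch c.
  hub-acyclic : ∀ (R : Fin m → Fin m → Bool) (c : Fin m) →
                (∀ u v → R u v ≡ true → u ≡ c ⊎ v ≡ c) → Acyclic R
  hub-acyclic R c touches
    C@record { distinct = (v₀≢v₁ ∷ v₀≢v₂ ∷ _) ∷ (v₁≢v₂ ∷ _) ∷ _ ; consec = e₀₁ , e₁₂ , _ }
    with touches _ _ e₀₁ | touches _ _ e₁₂ | cycle-v₂-neighbour C
  ... | inj₁ v₀≡c | inj₁ v₁≡c | _ = v₀≢v₁ (trans v₀≡c (sym v₁≡c))
  ... | inj₁ v₀≡c | inj₂ v₂≡c | _ = v₀≢v₂ (trans v₀≡c (sym v₂≡c))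
  ... | inj₂ v₁≡c | inj₂ v₂≡c | _ = v₁≢v₂ (trans v₁≡c (sym v₂≡c))
  ... | inj₂ v₁≡c | inj₁ _    | w , e₂w , w≢v₁ with touches _ _ e₂w
  ...   | inj₁ v₂≡c = v₁≢v₂ (trans v₁≡c (sym v₂≡c))
  ...   | inj₂ w≡c  = w≢v₁ (trans w≡c (sym v₁≡c))

map-cartesianProduct : ∀ {A B C : Set} (f : A → B → C) xs ys →
  map (uncurry f) (cartesianProduct xs ys) ≡ concatMap (λ x → map (f x) ys) xs
map-cartesianProduct f []       ys = refl
map-cartesianProduct f (x ∷ xs) ys = trans (List.map-++ (uncurry f) (map (x ,_) ys) _)
  (cong₂ _++_ (sym (List.map-∘ ys)) (map-cartesianProduct f xs ys))

edgeCount-cartesianProduct : ∀ {N} (R : Fin N → Fin N → Bool) →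
  edgeCount R ≡ List.sum (map (λ (i , j) → 𝟙 (does (i <? j) ∧ R i j)) (cartesianProduct (allFin N) (allFin N)))
edgeCount-cartesianProduct {N} R =
  sym (cong List.sum (map-cartesianProduct (λ i j → 𝟙 (does (i <? j) ∧ R i j)) (allFin N) (allFin N)))

module _ {N : ℕ} where

  -- A simple E-path from x to y through vertices satisfying C; inner lists the vertices after x.
  record Path (E : Fin N → Fin N → Set) (C : Fin N → Set) (x y : Fin N) : Set where
    field
      inner    : List (Fin N)
      linked   : Linked E (x ∷ inner)
      ends     : last′ x inner ≡ y
      distinct : AllPairs _≢_ (x ∷ inner)
      within   : All C (x ∷ inner)

  path-refl : ∀ {E C x} → C x → Path E C x x
  path-refl Cx = record { inner = [] ; linked = [-] ; ends = refl ; distinct = [] ∷ [] ; within = Cx ∷ [] }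

  path-map : ∀ {E E′ C C′ x y} → (∀ {u v} → E u v → E′ u v) → (∀ {u} → C u → C′ u) →
             Path E C x y → Path E′ C′ x y
  path-map E⊆E′ C⊆C′ p = record
    { inner = inner ; linked = Linked.map E⊆E′ linked ; ends = ends ; distinct = distinct ; within = All.map C⊆C′ within }
    where open Path p

  linked-++ : ∀ {E : Fin N → Fin N → Set} {x d} vs ws → Linked E (x ∷ vs) → E (last′ x vs) d →
              Linked E (d ∷ ws) → Linked E (x ∷ vs ++ d ∷ ws)
  linked-++ []       ws [-]       e l = e ∷ l
  linked-++ (v ∷ vs) ws (e′ ∷ l′) e l = e′ ∷ linked-++ vs ws l′ e l

  last′-++ : ∀ (x : Fin N) vs d ws → last′ x (vs ++ d ∷ ws) ≡ last′ d ws
  last′-++ x []       d ws = refl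
  last′-++ x (v ∷ vs) d ws = last′-++ v vs d ws

  apart : ∀ {C₁ C₂ : Fin N → Set} → (∀ {u} → C₁ u → C₂ u → ⊥) →
          ∀ {xs ys} → All C₁ xs → All C₂ ys → All (λ u → All (u ≢_) ys) xs
  apart disjoint []         _    = []
  apart disjoint (C₁u ∷ us) C₂ys =
    All.map (λ C₂v u≡v → disjoint C₁u (subst _ (sym u≡v) C₂v)) C₂ys ∷ apart disjoint us C₂ys

  path-join : ∀ {E C₁ C₂ C x c d y} → Path E C₁ x c → E c d → Path E C₂ d y →
              (∀ {u} → C₁ u → C₂ u → ⊥) → (∀ {u} → C₁ u → C u) → (∀ {u} → C₂ u → C u) →
              Path E C x y
  path-join {E} {x = x} {d = d} p e q disjoint C₁⊆C C₂⊆C = record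
    { inner    = p.inner ++ d ∷ q.inner
    ; linked   = linked-++ p.inner q.inner p.linked (subst (λ z → E z d) (sym p.ends) e) q.linked
    ; ends     = trans (last′-++ x p.inner d q.inner) q.ends
    ; distinct = AllPairs.++⁺ p.distinct q.distinct (apart disjoint p.within q.within)
    ; within   = All.++⁺ (All.map C₁⊆C p.within) (All.map C₂⊆C q.within)
    }
    where
    module p = Path p
    module q = Path q

-- Kruskal's argument: run through the ordered pairs, keeping a labelling L of the
-- components of the edges seen so far.  An edge inside P never joins two vertices of the
-- same component (with the path between them it would close a cycle), so relabelling one
-- of the two components lowers the number of roots in P by one; that number starts at
-- |P| and stays positive.
module ForestBound {N : ℕ} (R : Fin N → Fin N → Bool) (R-sym : ∀ i j → R i j ≡ R j i)
                   (acyclic : Acyclic R) (P : Fin N → Bool) where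

  edgeIn : Fin N → Fin N → Bool
  edgeIn i j = does (i <? j) ∧ (R i j ∧ (P i ∧ P j))

  record EdgeIn (i j : Fin N) : Set where
    field
      ordered : i Fin.< j
      edge    : R i j ≡ true
      source  : P i ≡ true
      target  : P j ≡ true

  edgeIn-sound : ∀ {i j} → edgeIn i j ≡ true → EdgeIn i j
  edgeIn-sound {i} {j} q = record
    { ordered = invert (subst (Reflects (i Fin.< j)) (∧-conicalˡ (does (i <? j)) _ q) (proof (i <? j)))
    ; edge    = ∧-conicalˡ (R i j) _ Rij∧Pi∧Pj
    ; source  = ∧-conicalˡ (P i) (P j) Pi∧Pj
    ; target  = ∧-conicalʳ (P i) (P j) Pi∧Pj
    }
    where
    Rij∧Pi∧Pj : (R i j ∧ (P i ∧ P j)) ≡ true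
    Rij∧Pi∧Pj = ∧-conicalʳ (does (i <? j)) (R i j ∧ (P i ∧ P j)) q
    Pi∧Pj : (P i ∧ P j) ≡ true
    Pi∧Pj = ∧-conicalʳ (R i j) (P i ∧ P j) Rij∧Pi∧Pj

  Pair : Set
  Pair = Fin N × Fin N

  Joined : List Pair → Fin N → Fin N → Set
  Joined ps u v = Any (λ (i , j) → edgeIn i j ≡ true × ((i , j) ≡ (u , v) ⊎ (i , j) ≡ (v , u))) ps

  Joined⇒R : ∀ {ps u v} → Joined ps u v → R u v ≡ true
  Joined⇒R (here (q , inj₁ refl)) = EdgeIn.edge (edgeIn-sound q)
  Joined⇒R (here (q , inj₂ refl)) = trans (R-sym _ _) (EdgeIn.edge (edgeIn-sound q))
  Joined⇒R (there j)              = Joined⇒R j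

  linked⇒consec : ∀ {ps} xs → Linked (Joined ps) xs → Consec R xs
  linked⇒consec []           []      = tt
  linked⇒consec (x ∷ [])     [-]     = tt
  linked⇒consec (x ∷ y ∷ xs) (j ∷ l) = Joined⇒R j , linked⇒consec (y ∷ xs) l

  Joined-reversed : ∀ {ps a b} → All ((a , b) ≢_) ps → Joined ps a b → edgeIn b a ≡ true
  Joined-reversed (ab∉ ∷ _) (here (q , inj₁ refl)) = ⊥-elim (ab∉ refl)
  Joined-reversed _         (here (q , inj₂ refl)) = q
  Joined-reversed (_ ∷ ab∉) (there j)              = Joined-reversed ab∉ j

  record UnionFind (E : Fin N → Fin N → Set) (L : Fin N → Fin N) : Set where
    field
      idempotent : ∀ x → L (L x) ≡ L x
      P-closed   : ∀ x → P x ≡ true → P (L x) ≡ true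
      connects   : ∀ x y → L x ≡ L y → Path E (λ w → L w ≡ L x) x y

  unionFind-id : ∀ {E} → UnionFind E (λ x → x)
  unionFind-id = record
    { idempotent = λ _ → refl
    ; P-closed   = λ _ Px → Px
    ; connects   = λ x y x≡y → subst (Path _ _ x) x≡y (path-refl refl)
    }

  unionFind-mono : ∀ {E E′ L} → (∀ {u v} → E u v → E′ u v) → UnionFind E L → UnionFind E′ L
  unionFind-mono E⊆E′ uf = record
    { idempotent = idempotent ; P-closed = P-closed
    ; connects   = λ x y Lx≡Ly → path-map E⊆E′ id (connects x y Lx≡Ly) }
    where open UnionFind uf

  roots : (Fin N → Fin N) → ℕ
  roots L = ∑[ x < N ] 𝟙 (P x ∧ does (L x ≟ x))

  relabel : (Fin N → Fin N) → Fin N → Fin N → Fin N → Fin N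
  relabel L r s x = if does (L x ≟ r) then s else L x

  module Merge {E E′ : Fin N → Fin N → Set} {L : Fin N → Fin N} (uf : UnionFind E L)
               (E⊆E′ : ∀ {u v} → E u v → E′ u v) {c d : Fin N} (cd : E′ c d) (dc : E′ d c)
               (Lc≢Ld : L c ≢ L d) (Pc : P c ≡ true) (Pd : P d ≡ true) where

    open UnionFind uf

    r s : Fin N
    r = L c
    s = L d

    L′ : Fin N → Fin N
    L′ = relabel L r s

    s≢r : s ≢ r
    s≢r s≡r = Lc≢Ld (sym s≡r)

    Ls≢r : L s ≢ r
    Ls≢r Ls≡r = s≢r (trans (sym (idempotent d)) Ls≡r)

    hit : ∀ x → L x ≡ r → L′ x ≡ s
    hit x Lx≡r = cong (λ b → if b then s else L x) (dec-true (L x ≟ r) Lx≡r)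

    miss : ∀ x → L x ≢ r → L′ x ≡ L x
    miss x Lx≢r = cong (λ b → if b then s else L x) (dec-false (L x ≟ r) Lx≢r)

    idempotent′ : ∀ x → L′ (L′ x) ≡ L′ x
    idempotent′ x with toSum (L x ≟ r)
    ... | inj₁ Lx≡r = trans (cong L′ (hit x Lx≡r))
                     (trans (miss s Ls≢r) (trans (idempotent d) (sym (hit x Lx≡r))))
    ... | inj₂ Lx≢r = trans (cong L′ (miss x Lx≢r))
                     (trans (miss (L x) (λ LLx≡r → Lx≢r (trans (sym (idempotent x)) LLx≡r)))
                            (trans (idempotent x) (sym (miss x Lx≢r))))

    P-closed′ : ∀ x → P x ≡ true → P (L′ x) ≡ true
    P-closed′ x Px with toSum (L x ≟ r)
    ... | inj₁ Lx≡r = subst (λ z → P z ≡ true) (sym (hit x Lx≡r)) (P-closed d Pd)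
    ... | inj₂ Lx≢r = subst (λ z → P z ≡ true) (sym (miss x Lx≢r)) (P-closed x Px)

    relabelled : ∀ {u w} → L w ≡ L u → L′ w ≡ L′ u
    relabelled = cong (λ z → if does (z ≟ r) then s else z)

    bridge : ∀ {x u v y} → E′ u v → L x ≡ L u → L v ≡ L y → L u ≢ L v → L′ x ≡ L′ y →
             Path E′ (λ w → L′ w ≡ L′ x) x y
    bridge {x} {u} {v} {y} uv Lx≡Lu Lv≡Ly Lu≢Lv L′x≡L′y = path-join
      (path-map E⊆E′ id (connects x u Lx≡Lu)) uv (path-map E⊆E′ id (connects v y Lv≡Ly))
      (λ Lw≡Lx Lw≡Lv → Lu≢Lv (trans (sym Lx≡Lu) (trans (sym Lw≡Lx) Lw≡Lv)))
      relabelled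
      (λ Lw≡Lv → trans (relabelled (trans Lw≡Lv Lv≡Ly)) (sym L′x≡L′y))

    connects′ : ∀ x y → L′ x ≡ L′ y → Path E′ (λ w → L′ w ≡ L′ x) x y
    connects′ x y L′x≡L′y with toSum (L x ≟ r) | toSum (L y ≟ r)
    ... | inj₁ Lx≡r | inj₁ Ly≡r = path-map E⊆E′ relabelled (connects x y (trans Lx≡r (sym Ly≡r)))
    ... | inj₂ Lx≢r | inj₂ Ly≢r =
      path-map E⊆E′ relabelled (connects x y (trans (sym (miss x Lx≢r)) (trans L′x≡L′y (miss y Ly≢r))))
    ... | inj₁ Lx≡r | inj₂ Ly≢r =
      bridge cd Lx≡r (trans (sym (hit x Lx≡r)) (trans L′x≡L′y (miss y Ly≢r))) Lc≢Ld L′x≡L′y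
    ... | inj₂ Lx≢r | inj₁ Ly≡r =
      bridge dc (trans (sym (miss x Lx≢r)) (trans L′x≡L′y (hit y Ly≡r))) (sym Ly≡r) (Lc≢Ld ∘ sym) L′x≡L′y

    unionFind : UnionFind E′ L′
    unionFind = record { idempotent = idempotent′ ; P-closed = P-closed′ ; connects = connects′ }

    roots-decrease : roots L ≡ suc (roots L′)
    roots-decrease = ∑-suc-at _ _ r
      (trans (cong₂ (λ p b → 𝟙 (p ∧ b)) (P-closed c Pc) (dec-true (L r ≟ r) (idempotent c)))
             (cong suc (sym (cong₂ (λ p b → 𝟙 (p ∧ b)) (P-closed c Pc) (dec-false (L′ r ≟ r) L′r≢r)))))
      unchanged
      where
      L′r≢r : L′ r ≢ r
      L′r≢r L′r≡r = s≢r (trans (sym (hit r (idempotent c))) L′r≡r)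

      unchanged : ∀ x → x ≢ r → 𝟙 (P x ∧ does (L x ≟ x)) ≡ 𝟙 (P x ∧ does (L′ x ≟ x))
      unchanged x x≢r with toSum (L x ≟ r)
      ... | inj₁ Lx≡r = cong (λ b → 𝟙 (P x ∧ b))
        (trans (dec-false (L x ≟ x) (λ Lx≡x → x≢r (trans (sym Lx≡x) Lx≡r)))
               (sym (dec-false (L′ x ≟ x) (λ L′x≡x → s≢r (trans (sym (idempotent d))
                  (trans (cong L (trans (sym (hit x Lx≡r)) L′x≡x)) Lx≡r))))))
      ... | inj₂ Lx≢r = cong (λ z → 𝟙 (P x ∧ does (z ≟ x))) (sym (miss x Lx≢r))

  distinct-labels : ∀ {ps L a b} → UnionFind (Joined ps) L → All ((a , b) ≢_) ps → edgeIn a b ≡ true → L a ≢ L b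
  distinct-labels {a = a} {b} uf ab∉ q La≡Lb with UnionFind.connects uf a b La≡Lb
  ... | record { inner = [] ; ends = a≡b } = Fin.<-irrefl a≡b (EdgeIn.ordered (edgeIn-sound {a} {b} q))
  ... | record { inner = _ ∷ [] ; linked = j ∷ [-] ; ends = refl } =
    Fin.<-asym (EdgeIn.ordered (edgeIn-sound {a} {b} q)) (EdgeIn.ordered (edgeIn-sound {b} {a} (Joined-reversed ab∉ j)))
  ... | record { inner = v₁ ∷ v₂ ∷ rest ; linked = l ; ends = ends ; distinct = distinct } = acyclic record
    { v₀ = a ; v₁ = v₁ ; v₂ = v₂ ; rest = rest ; distinct = distinct ; consec = linked⇒consec _ l
    ; closing = subst (λ z → R z a ≡ true) (sym ends) (trans (R-sym b a) (EdgeIn.edge (edgeIn-sound {a} {b} q))) }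

  countEdgesIn : List Pair → ℕ
  countEdgesIn ps = List.sum (map (λ (i , j) → 𝟙 (edgeIn i j)) ps)

  kruskal : ∀ ps → Unique ps →
            Σ (Fin N → Fin N) λ L → UnionFind (Joined ps) L × countEdgesIn ps + roots L ≡ roots (λ x → x)
  kruskal []             []              = (λ x → x) , unionFind-id , refl
  kruskal ((a , b) ∷ ps) (ab∉ ∷ unique) with kruskal ps unique | edgeIn a b in q
  ... | L , uf , balance | false = L , unionFind-mono there uf , balance
  ... | L , uf , balance | true  = L′ , unionFind , (begin
    suc (countEdgesIn ps + roots L′) ≡⟨ ℕ.+-suc (countEdgesIn ps) (roots L′) ⟨
    countEdgesIn ps + suc (roots L′) ≡⟨ cong (_+_ (countEdgesIn ps)) roots-decrease ⟨
    countEdgesIn ps + roots L        ≡⟨ balance ⟩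
    roots (λ x → x)                  ∎)
    where
    open ≡-Reasoning
    open EdgeIn (edgeIn-sound {a} {b} q)
    open Merge uf there (here (q , inj₁ refl)) (here (q , inj₂ refl)) (distinct-labels uf ab∉ q) source target

  roots-id : roots (λ x → x) ≡ ∑[ x < N ] 𝟙 (P x)
  roots-id = sum-cong-≗ {N} (λ x →
    trans (cong (λ b → 𝟙 (P x ∧ b)) (dec-true (x ≟ x) refl)) (cong 𝟙 (∧-identityʳ (P x))))

  edges<size : ∀ c → P c ≡ true → edgeCount (λ i j → R i j ∧ (P i ∧ P j)) ℕ.< ∑[ x < N ] 𝟙 (P x)
  edges<size c Pc with kruskal (cartesianProduct (allFin N) (allFin N)) (cartesianProduct⁺ (allFin⁺ N) (allFin⁺ N))
  ... | L , uf , balance = begin-strict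
    edgeCount (λ i j → R i j ∧ (P i ∧ P j)) ≡⟨ edgeCount-cartesianProduct {N} (λ i j → R i j ∧ (P i ∧ P j)) ⟩
    countEdgesIn pairs                      <⟨ ℕ.m<m+n (countEdgesIn pairs) root-exists ⟩
    countEdgesIn pairs + roots L            ≡⟨ balance ⟩
    roots (λ x → x)                         ≡⟨ roots-id ⟩
    ∑[ x < N ] 𝟙 (P x)                      ∎
    where
    open ℕ.≤-Reasoning
    open UnionFind uf
    pairs : List Pair
    pairs = cartesianProduct (allFin N) (allFin N)
    root-exists : 0 ℕ.< roots L
    root-exists = ℕ.<-≤-trans
      (subst (0 ℕ.<_) (sym (cong₂ (λ p b → 𝟙 (p ∧ b)) (P-closed c Pc) (dec-true (L (L c) ≟ L c) (idempotent c))))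
             ℕ.z<s)
      (term≤∑ (λ x → 𝟙 (P x ∧ does (L x ≟ x))) (L c))

<ᵇ-sound : ∀ a b → (a <ᵇ b) ≡ true → a ℕ.< b
<ᵇ-sound a b a<ᵇb = ℕ.<ᵇ⇒< a b (subst T (sym a<ᵇb) tt)

<ᵇ-complete : ∀ {a b} → a ℕ.< b → (a <ᵇ b) ≡ true
<ᵇ-complete {zero}  (s≤s _)   = refl
<ᵇ-complete {suc a} (s≤s a<b) = <ᵇ-complete a<b

symmetrise : (ℕ → ℕ → Bool) → ℕ → ℕ → Bool
symmetrise F a b = if a <ᵇ b then F a b else if b <ᵇ a then F b a else false

symmetrise-sym : ∀ F a b → symmetrise F a b ≡ symmetrise F b a
symmetrise-sym F a b with a <ᵇ b in a<b | b <ᵇ a in b<a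
... | true  | true  = ⊥-elim (ℕ.<-asym (<ᵇ-sound a b a<b) (<ᵇ-sound b a b<a))
... | true  | false = refl
... | false | true  = refl
... | false | false = refl

symmetrise-irrefl : ∀ F a → symmetrise F a a ≡ false
symmetrise-irrefl F a with a <ᵇ a in a<a
... | true  = ⊥-elim (ℕ.<-irrefl refl (<ᵇ-sound a a a<a))
... | false = refl

symmetrise-mono : ∀ {F F′} → (∀ a b → F a b ≡ true → F′ a b ≡ true) →
                 ∀ a b → symmetrise F a b ≡ true → symmetrise F′ a b ≡ true
symmetrise-mono F⊆F′ a b with a <ᵇ b | b <ᵇ a
... | true  | _     = F⊆F′ a b
... | false | true  = F⊆F′ b a
... | false | false = λ ()

graphOf : ℕ → (ℕ → ℕ → Bool) → Graph
graphOf N F = record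
  { n      = N
  ; adj    = λ i j → symmetrise F (toℕ i) (toℕ j)
  ; sym    = λ i j → symmetrise-sym F (toℕ i) (toℕ j)
  ; irrefl = λ i → symmetrise-irrefl F (toℕ i)
  }

subgraphOf : ∀ {N F} F′ → (∀ a b → F′ a b ≡ true → F a b ≡ true) → SpanningSubgraph (graphOf N F)
subgraphOf F′ F′⊆F = record
  { sub     = λ i j → symmetrise F′ (toℕ i) (toℕ j)
  ; sub-sym = λ i j → symmetrise-sym F′ (toℕ i) (toℕ j)
  ; sub⊆    = λ i j → symmetrise-mono F′⊆F (toℕ i) (toℕ j)
  }

module Construction (M N′ : ℕ) (m≤N : suc M ≤ suc N′) where

  m N : ℕ
  m = suc M
  N = suc N′

  -- On a pair a < b: both ends lie in the clique 0,…,m−1, or a is the hub 0.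
  clique-or-spoke spoke : ℕ → ℕ → Bool
  clique-or-spoke a b = (b <ᵇ m) ∨ (a ≡ᵇ 0)
  spoke           a b = a ≡ᵇ 0

  G : Graph
  G = graphOf N clique-or-spoke

  star : SpanningSubgraph G
  star = subgraphOf spoke (λ a b a≡ᵇ0 → trans (cong ((b <ᵇ m) ∨_) a≡ᵇ0) (∨-zeroʳ (b <ᵇ m)))

  inClique : Fin N → Bool
  inClique i = toℕ i <ᵇ m

  ω : Weighting G
  ω i j = if inClique i ∧ inClique j then 1ℚ else 0ℚ

  cliqueEdges : ℕ
  cliqueEdges = ∑[ i < N ] ∑[ j < N ] 𝟙 ((toℕ i <ᵇ toℕ j) ∧ (toℕ j <ᵇ m))

  ω-nonNeg : NonNegWeighting G ω
  ω-nonNeg i j _ with inClique i ∧ inClique j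
  ... | true  = ℕtoℚ-mono-≤ {0} {1} z≤n
  ... | false = ℚ.≤-refl

  to-hub : ∀ u → Walk (sub star) u zero
  to-hub zero    = here
  to-hub (suc u) = step refl here

  from-hub : ∀ v → Walk (sub star) zero v
  from-hub zero    = here
  from-hub (suc v) = step refl here

  star-connected : Connected (sub star)
  star-connected u v = walk-++ (to-hub u) (from-hub v)

  G-connected : Connected (adj G)
  G-connected u v = walk-map (sub⊆ star) (star-connected u v)

  spoke-at-hub : ∀ a b → symmetrise spoke (suc a) (suc b) ≡ false
  spoke-at-hub a b with a <ᵇ b | b <ᵇ a
  ... | true  | _     = refl
  ... | false | true  = refl
  ... | false | false = refl

  star-acyclic : Acyclic (sub star)
  star-acyclic = hub-acyclic (sub star) zero touches
    where
    touches : ∀ u v → sub star u v ≡ true → u ≡ zero ⊎ v ≡ zero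
    touches zero    _       _ = inj₁ refl
    touches (suc u) zero    _ = inj₂ refl
    touches (suc u) (suc v) e with trans (sym e) (spoke-at-hub (toℕ u) (toℕ v))
    ... | ()

  clique-pair : ∀ a b → a ℕ.< b → ((a <ᵇ m) ∧ (b <ᵇ m)) ≡ (b <ᵇ m)
  clique-pair a b a<b with b <ᵇ m in b<m
  ... | false = ∧-zeroʳ (a <ᵇ m)
  ... | true  = cong (_∧ true) (<ᵇ-complete (ℕ.<-trans a<b (<ᵇ-sound b m b<m)))

  upper-in-clique : ∀ F a b →
    𝟙 ((a <ᵇ b) ∧ (symmetrise F a b ∧ ((a <ᵇ m) ∧ (b <ᵇ m)))) ≡ 𝟙 ((a <ᵇ b) ∧ (F a b ∧ (b <ᵇ m)))
  upper-in-clique F a b with a <ᵇ b in a<b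
  ... | false = refl
  ... | true  = cong (λ x → 𝟙 (F a b ∧ x)) (clique-pair a b (<ᵇ-sound a b a<b))

  ωH-inClique : ∀ H → ωH G ω H ≡ ℕtoℚ (edgeCount (λ i j → sub H i j ∧ (inClique i ∧ inClique j)))
  ωH-inClique H = weightOf-indicator (sub H) (λ i j → inClique i ∧ inClique j)

  ωG≡cliqueEdges : ωG G ω ≡ ℕtoℚ cliqueEdges
  ωG≡cliqueEdges = trans (weightOf-indicator (adj G) (λ i j → inClique i ∧ inClique j)) (cong ℕtoℚ (begin
    edgeCount (λ i j → adj G i j ∧ (inClique i ∧ inClique j))
      ≡⟨ edgeCount≡∑∑ (λ i j → adj G i j ∧ (inClique i ∧ inClique j)) ⟩
    ∑[ i < N ] ∑[ j < N ] 𝟙 ((toℕ i <ᵇ toℕ j) ∧ (adj G i j ∧ (inClique i ∧ inClique j)))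
      ≡⟨ sum-cong-≗ {N} (λ i → sum-cong-≗ {N} (λ j → upper-in-clique clique-or-spoke (toℕ i) (toℕ j))) ⟩
    ∑[ i < N ] ∑[ j < N ] 𝟙 ((toℕ i <ᵇ toℕ j) ∧ (clique-or-spoke (toℕ i) (toℕ j) ∧ (toℕ j <ᵇ m)))
      ≡⟨ sum-cong-≗ {N} (λ i → sum-cong-≗ {N} (λ j → cong (λ x → 𝟙 ((toℕ i <ᵇ toℕ j) ∧ x))
           (trans (∧-comm (clique-or-spoke (toℕ i) (toℕ j)) _) (∧-abs-∨ (toℕ j <ᵇ m) (toℕ i ≡ᵇ 0))))) ⟩
    cliqueEdges ∎))
    where open ≡-Reasoning

  ω-star : ωH G ω star ≡ ℕtoℚ M
  ω-star = trans (ωH-inClique star) (cong ℕtoℚ (begin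
    edgeCount (λ i j → sub star i j ∧ (inClique i ∧ inClique j))
      ≡⟨ edgeCount≡∑∑ (λ i j → sub star i j ∧ (inClique i ∧ inClique j)) ⟩
    ∑[ i < N ] ∑[ j < N ] 𝟙 ((toℕ i <ᵇ toℕ j) ∧ (sub star i j ∧ (inClique i ∧ inClique j)))
      ≡⟨ sum-cong-≗ {N} (λ i → sum-cong-≗ {N} (λ j → upper-in-clique spoke (toℕ i) (toℕ j))) ⟩
    ∑[ i < N ] ∑[ j < N ] 𝟙 ((toℕ i <ᵇ toℕ j) ∧ ((toℕ i ≡ᵇ 0) ∧ (toℕ j <ᵇ m)))
      ≡⟨ count-star m m≤N ⟩
    M ∎))
    where open ≡-Reasoning

  edge-split : ∀ a b → (b <ᵇ N) ≡ true →
    𝟙 ((a <ᵇ b) ∧ symmetrise clique-or-spoke a b)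
      ≤ 𝟙 ((a <ᵇ b) ∧ (b <ᵇ m)) + 𝟙 ((a <ᵇ b) ∧ ((a ≡ᵇ 0) ∧ (b <ᵇ N)))
  edge-split a b b<N with a <ᵇ b
  ... | false = z≤n
  ... | true rewrite b<N | ∧-identityʳ (a ≡ᵇ 0) = 𝟙-∨ (b <ᵇ m) (a ≡ᵇ 0)

  edgeCount-G : edgeCount (adj G) ≤ cliqueEdges + N′
  edgeCount-G = begin
    edgeCount (adj G) ≡⟨ edgeCount≡∑∑ (adj G) ⟩
    ∑[ i < N ] ∑[ j < N ] 𝟙 ((toℕ i <ᵇ toℕ j) ∧ adj G i j)
      ≤⟨ ∑-mono-≤ {N} (λ i → ∑-mono-≤ {N} (λ j →
           edge-split (toℕ i) (toℕ j) (<ᵇ-complete (toℕ<n {N} j)))) ⟩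
    ∑[ i < N ] ∑[ j < N ] (clique i j + spokes i j)
      ≡⟨ sum-cong-≗ {N} (λ i → ∑-distrib-+ {N} (clique i) (spokes i)) ⟩
    ∑[ i < N ] (∑[ j < N ] clique i j + ∑[ j < N ] spokes i j)
      ≡⟨ ∑-distrib-+ {N} (λ i → ∑[ j < N ] clique i j) (λ i → ∑[ j < N ] spokes i j) ⟩
    cliqueEdges + ∑[ i < N ] ∑[ j < N ] spokes i j
      ≡⟨ cong (_+_ cliqueEdges) (count-star N ℕ.≤-refl) ⟩
    cliqueEdges + N′ ∎
    where
    open ℕ.≤-Reasoning
    clique spokes : Fin N → Fin N → ℕ
    clique i j = 𝟙 ((toℕ i <ᵇ toℕ j) ∧ (toℕ j <ᵇ m))
    spokes i j = 𝟙 ((toℕ i <ᵇ toℕ j) ∧ ((toℕ i ≡ᵇ 0) ∧ (toℕ j <ᵇ N)))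

  star-maximum : IsMaxSpanningTree G ω star
  star-maximum = (star-connected , star-acyclic) , λ T (_ , T-acyclic) → begin
    ωH G ω T
      ≡⟨ ωH-inClique T ⟩
    ℕtoℚ (edgeCount (λ i j → sub T i j ∧ (inClique i ∧ inClique j)))
      ≤⟨ ℕtoℚ-mono-≤ (forest-bound T T-acyclic) ⟩
    ℕtoℚ M
      ≡⟨ ω-star ⟨
    ωH G ω star ∎
    where
    open ℚ.≤-Reasoning
    forest-bound : ∀ T → Acyclic (sub T) → edgeCount (λ i j → sub T i j ∧ (inClique i ∧ inClique j)) ≤ M
    forest-bound T T-acyclic = ℕ.≤-pred (ℕ.<-≤-trans
      (ForestBound.edges<size (sub T) (sub-sym T) T-acyclic inClique zero refl)
      (ℕ.≤-reflexive (count-below m m≤N)))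


  cliqueEdges-double : 2 * cliqueEdges ≡ m * M
  cliqueEdges-double = count-pairs-below m m≤N

  ωG-positive : 0 ℕ.< M → 0ℚ < ωG G ω
  ωG-positive M>0 = subst (0ℚ <_) (sym ωG≡cliqueEdges) (ℕtoℚ-mono-< {0} {cliqueEdges}
    (ℕ.*-cancelˡ-< 2 0 cliqueEdges (subst (0 ℕ.<_) (sym cliqueEdges-double) (ℕ.<-≤-trans M>0 (ℕ.m≤n*m M m)))))

  ratio-below : ∀ n d .(c : Coprime n (suc d)) →
                M * edgeCount (adj G) * suc d ℕ.< n * (cliqueEdges * N′) → RatioBelow G ω star (mkℚ (+ n) d c)
  ratio-below n d c ineq = begin-strict
    ωH G ω star ℚ.* ℕtoℚ E                ≡⟨ cong (ℚ._* ℕtoℚ E) ω-star ⟩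
    ℕtoℚ M ℚ.* ℕtoℚ E                     ≡⟨ ℕtoℚ-homo-* M E ⟨
    ℕtoℚ (M * E)                          <⟨ ℕtoℚ-<-* (M * E) (cliqueEdges * N′) n d c ineq ⟩
    ε ℚ.* ℕtoℚ (cliqueEdges * N′)         ≡⟨ cong (ε ℚ.*_) (ℕtoℚ-homo-* cliqueEdges N′) ⟩
    ε ℚ.* (ℕtoℚ cliqueEdges ℚ.* ℕtoℚ N′)  ≡⟨ cong (λ w → ε ℚ.* (w ℚ.* ℕtoℚ N′)) ωG≡cliqueEdges ⟨
    ε ℚ.* (ωG G ω ℚ.* ℕtoℚ (N ∸ 1))       ∎
    where
    open ℚ.≤-Reasoning
    E : ℕ
    E = edgeCount (adj G)
    ε : ℚ
    ε = mkℚ (+ n) d c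

-- m = 4(d+1) = suc M clique vertices among N = m² = suc N′ vertices.
ratio-bound : ∀ d k X E → let M = 3 + 4 * d; N′ = M * (2 + M) in
              2 * X ≡ suc M * M → E ≤ X + N′ → M * E * suc d ℕ.< suc k * (X * N′)
ratio-bound d k X E 2X≡mM E≤X+N′ = ℕ.<-≤-trans
  (ℕ.*-cancelˡ-< 2 (M * E * K) (X * N′) (begin-strict
    2 * (M * E * K)             ≤⟨ ℕ.*-monoʳ-≤ 2 (ℕ.*-monoˡ-≤ K (ℕ.*-monoʳ-≤ M E≤X+N′)) ⟩
    2 * (M * (X + N′) * K)      ≡⟨ rearrange₁ M X N′ K ⟩
    M * ((2 * X + 2 * N′) * K)  ≡⟨ cong (λ y → M * ((y + 2 * N′) * K)) 2X≡mM ⟩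
    M * ((m * M + 2 * N′) * K)  <⟨ ℕ.*-monoʳ-< M core ⟩
    M * (m * N′)                ≡⟨ rearrange₂ M m N′ ⟩
    m * M * N′                  ≡⟨ cong (_* N′) 2X≡mM ⟨
    2 * X * N′                  ≡⟨ ℕ.*-assoc 2 X N′ ⟩
    2 * (X * N′)                ∎))
  (ℕ.m≤n*m (X * N′) (suc k))
  where
  open ℕ.≤-Reasoning
  M m N′ K : ℕ
  M  = 3 + 4 * d
  m  = suc M
  N′ = M * (2 + M)
  K  = suc d
  rearrange₁ : ∀ M X N′ K → 2 * (M * (X + N′) * K) ≡ M * ((2 * X + 2 * N′) * K)
  rearrange₁ = solve-∀
  rearrange₂ : ∀ M m N′ → M * (m * N′) ≡ m * M * N′
  rearrange₂ = solve-∀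
  slack : ∀ d → (4 + 4 * d) * ((3 + 4 * d) * (5 + 4 * d)) ≡
    ((4 + 4 * d) * (3 + 4 * d) + 2 * ((3 + 4 * d) * (5 + 4 * d))) * suc d + suc (17 + 54 * d + 52 * (d * d) + 16 * (d * d * d))
  slack = solve-∀
  core : (m * M + 2 * N′) * K ℕ.< m * N′
  core = subst ((m * M + 2 * N′) * K ℕ.<_) (sym (slack d)) (ℕ.m<m+n _ ℕ.z<s)

theorem1 : ∀ (ε : ℚ) → 0ℚ < ε →
    ∃[ G ] ∃[ ω ]
    Connected (adj G) × NonNegWeighting G ω × 0ℚ < ωG G ω ×
    ∃[ T ] (IsMaxSpanningTree G ω T × RatioBelow G ω T ε)
theorem1 (mkℚ (+ zero)  _ _) (*<* (+<+ ()))
theorem1 (mkℚ -[1+ _ ]  _ _) (*<* ())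
theorem1 (mkℚ (+ suc k) d c) _ =
  G , ω , G-connected , ω-nonNeg , ωG-positive ℕ.z<s , star , star-maximum ,
  ratio-below (suc k) d c (ratio-bound d k cliqueEdges (edgeCount (adj G)) cliqueEdges-double edgeCount-G)
  where
  M N′ : ℕ
  M  = 3 + 4 * d
  N′ = M * (2 + M)
  open Construction M N′ (s≤s (ℕ.m≤m*n M (2 + M)))
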